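{- Let $D$ be a diagnoser for a partially observable plant $P$, and let $A$ be an alarm of $D$ whose alarm condition has temporal condition $\tau$. If $D$ is correct for $A$, i.e. $D\otimes P\models G([A]_o\to\tau)$, then $D\otimes P\models G([A]_o\to[K\tau]_o)$.
   Context: An LTS is $S=\langle V,E,I,\mathcal T\rangle$ (finite set $V$ of variables over a finite domain, events $E$, initial formula $I$, transition formulas $\mathcal T(e)$ over $V\cup V'$). A trace is an infinite sequence $\sigma=s_0,e_0,s_1,e_1,\dots$ with $s_0\models I$ and $\langle s_k,s_{k+1}\rangle\models\mathcal T(e_k)$ (deadlock freedom assumed); $\sigma^k=s_0,e_0,\dots,s_k$. Deterministic: exactly one initial state and exactly one successor per event from each reachable state. A plant $P=\langle V^P,E^P,I^P,\mathcal T^P,E^P_o\rangle$ has observable events $E^P_o\subseteq E^P$. $\mathit{obs}(\sigma^k)$ = subsequence of observable events among $e_0,\dots,e_{k-1}$; $\mathit{ObsPoint}(\sigma,i)$ iff $i>0$ and $e_{i-1}\in E_o$; $((\sigma_1,i),(\sigma_2,j))\in\mathit{ObsEq}$ iff ($\mathit{ObsPoint}(\sigma_1,i)\Leftrightarrow\mathit{ObsPoint}(\sigma_2,j)$) and $\mathit{obs}(\sigma_1^i)=\mathit{obs}(\sigma_2^j)$. A diagnoser for $P$ is a deterministic LTS $D$ with event set $E^P_o$, variables disjoint from $V^P$, containing Boolean alarm variables. $D\otimes P$ is the asynchronous product (on unobservable plant events $D$'s variables are unchanged, on observable events both move), regarded as partially observable with observable events $E^P_o$. Logic: LTL with past (reflexive;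 $Y\beta$ at $i$ iff $i>0$ and $\beta$ at $i-1$; $O$ = once in the past including now; $O^{\le n}\beta=\beta\vee Y\beta\vee\dots\vee Y^n\beta$; $\sigma,i\models e$ iff $e_i=e$) extended with $K$: $\sigma_1,i\models K\beta$ iff for every trace $\sigma_2$ of the system and every $j$ with $((\sigma_1,i),(\sigma_2,j))\in\mathit{ObsEq}$, $\sigma_2,j\models\beta$. $[\phi]_o$ abbreviates $\phi\wedge Y\bigvee_{e\in E_o}e$. A system satisfies a formula iff all its traces do at position 0. The temporal condition of an alarm condition with diagnosis condition $\beta$ (formula over plant propositions built with $\wedge,\neg,O,Y$) is $\tau=Y^d\beta$ for $\mathrm{ExactDel}(A,\beta,d)$, $\tau=O^{\le d}\beta$ for $\mathrm{BoundDel}(A,\beta,d)$, and $\tau=O\beta$ for $\mathrm{FiniteDel}(A,\beta)$. -}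

module Defs where

open import Data.Nat using (ℕ; zero; suc; _≤_)
open import Data.Fin using (Fin)
open import Data.Bool using (Bool; true; false; T; if_then_else_)
open import Data.List using (List; []; _∷ʳ_)
open import Data.Product using (Σ; _×_; _,_; proj₁; proj₂)
open import Data.Sum using (_⊎_)
open import Data.Empty using (⊥)
open import Relation.Nullary using (¬_)
open import Relation.Binary.PropositionalEquality using (_≡_)
open import Function.Bundles using (_↔_)

-- Finiteness (a state space of finitely many variables over finite
-- domains is a finite set of valuations).

Finite : Set → Set
Finite A = Σ ℕ λ n → A ↔ Fin n

data Reachable {E S : Set} (Init : S → Set) (Trans : E → S → S → Set) : S → Set where
  reach-init : ∀ {s} → Init s → Reachable Init Trans s
  reach-step : ∀ {s s' e} → Reachable Init Trans s → Trans e s s' → Reachable Init Trans s'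

record Plant : Set₁ where
  field
    Event    : Set
    State    : Set
    finState : Finite State
    Init     : State → Set
    Trans    : Event → State → State → Set
    obs      : Event → Bool

    deadlockFree : ∀ s → Reachable Init Trans s → Σ Event λ e → Σ State λ s' → Trans e s s'

  Observable : Event → Set
  Observable e = T (obs e)

ObsEvent : Plant → Set
ObsEvent P = Σ (Plant.Event P) (Plant.Observable P)

-- Diagnoser: deterministic LTS over the observable events of P, with
-- Boolean alarm variables. (Its state space is disjoint from P's since
-- the product state is a pair.)

record Diagnoser (P : Plant) : Set₁ where
  field
    State    : Set
    finState : Finite State
    Init     : State → Set
    Trans    : ObsEvent P → State → State → Set
    Alarm    : Set
    alarm    : Alarm → State → Bool
    detInit  : Σ State λ s → Init s × (∀ s' → Init s' → s' ≡ s)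
    detTrans : ∀ s → Reachable Init Trans s → (e : ObsEvent P) →
               Σ State λ s' → Trans e s s' × (∀ s'' → Trans e s s'' → s'' ≡ s')

record Trace (E S : Set) (Init : S → Set) (Trans : E → S → S → Set) : Set where
  field
    states : ℕ → S
    events : ℕ → E
    init   : Init (states 0)
    step   : ∀ k → Trans (events k) (states k) (states (suc k))
open Trace public

module _ (P : Plant) (D : Diagnoser P) where
  private
    module P = Plant P
    module D = Diagnoser D

  ProdState : Set
  ProdState = D.State × P.State

  ProdInit : ProdState → Set
  ProdInit (d , p) = D.Init d × P.Init p

  DStep : P.Event → D.State → D.State → Set
  DStep e d d' = (Σ (P.Observable e) λ o → D.Trans (e , o) d d')
               ⊎ (¬ P.Observable e × d' ≡ d)

  ProdTrans : P.Event → ProdState → ProdState → Set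
  ProdTrans e (d , p) (d' , p') = P.Trans e p p' × DStep e d d'

  PTrace : Set
  PTrace = Trace P.Event ProdState ProdInit ProdTrans

  obsSeq : PTrace → ℕ → List P.Event
  obsSeq σ zero    = []
  obsSeq σ (suc k) = if P.obs (events σ k)
                       then obsSeq σ k ∷ʳ events σ k
                       else obsSeq σ k

  ObsPoint : PTrace → ℕ → Set
  ObsPoint σ zero    = ⊥
  ObsPoint σ (suc i) = P.Observable (events σ i)

  ObsEq : PTrace → ℕ → PTrace → ℕ → Set
  ObsEq σ₁ i σ₂ j =
    ((ObsPoint σ₁ i → ObsPoint σ₂ j) × (ObsPoint σ₂ j → ObsPoint σ₁ i))
    × obsSeq σ₁ i ≡ obsSeq σ₂ j

  TProp : Set₁
  TProp = PTrace → ℕ → Set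

  _∧ᶠ_ : TProp → TProp → TProp
  (φ ∧ᶠ ψ) σ i = φ σ i × ψ σ i

  _∨ᶠ_ : TProp → TProp → TProp
  (φ ∨ᶠ ψ) σ i = φ σ i ⊎ ψ σ i

  ¬ᶠ_ : TProp → TProp
  (¬ᶠ φ) σ i = ¬ φ σ i

  _⇒ᶠ_ : TProp → TProp → TProp
  (φ ⇒ᶠ ψ) σ i = φ σ i → ψ σ i

  Yᶠ : TProp → TProp
  Yᶠ φ σ zero    = ⊥
  Yᶠ φ σ (suc i) = φ σ i

  Oᶠ : TProp → TProp
  Oᶠ φ σ i = Σ ℕ λ k → k ≤ i × φ σ k

  Gᶠ : TProp → TProp
  Gᶠ φ σ i = ∀ k → i ≤ k → φ σ k

  Yⁿ : ℕ → TProp → TProp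
  Yⁿ zero    φ = φ
  Yⁿ (suc n) φ = Yᶠ (Yⁿ n φ)

  O≤ : ℕ → TProp → TProp
  O≤ zero    φ = φ
  O≤ (suc n) φ = O≤ n φ ∨ᶠ Yⁿ (suc n) φ

  evᶠ : P.Event → TProp
  evᶠ e σ i = events σ i ≡ e

  obsEvᶠ : TProp
  obsEvᶠ σ i = P.Observable (events σ i)

  [_]ₒ : TProp → TProp
  [ φ ]ₒ = φ ∧ᶠ Yᶠ obsEvᶠ

  Kᶠ : TProp → TProp
  Kᶠ φ σ₁ i = ∀ (σ₂ : PTrace) j → ObsEq σ₁ i σ₂ j → φ σ₂ j

  alarmᶠ : D.Alarm → TProp
  alarmᶠ A σ i = T (D.alarm A (proj₁ (states σ i)))

  Sat : TProp → Set
  Sat φ = ∀ (σ : PTrace) → φ σ 0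

data PlantFormula (P : Plant) : Set where
  prop  : (Plant.State P → Bool) → PlantFormula P
  event : Plant.Event P → PlantFormula P
  _∧ᵖ_  : PlantFormula P → PlantFormula P → PlantFormula P
  ¬ᵖ_   : PlantFormula P → PlantFormula P
  Oᵖ    : PlantFormula P → PlantFormula P
  Yᵖ    : PlantFormula P → PlantFormula P

module _ {P : Plant} {D : Diagnoser P} where
  ⟦_⟧ : PlantFormula P → TProp P D
  ⟦ prop p  ⟧ σ i = T (p (proj₂ (states σ i)))
  ⟦ event e ⟧     = evᶠ P D e
  ⟦ φ ∧ᵖ ψ  ⟧     = _∧ᶠ_ P D ⟦ φ ⟧ ⟦ ψ ⟧
  ⟦ ¬ᵖ φ    ⟧     = ¬ᶠ_ P D ⟦ φ ⟧
  ⟦ Oᵖ φ    ⟧     = Oᶠ P D ⟦ φ ⟧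
  ⟦ Yᵖ φ    ⟧     = Yᶠ P D ⟦ φ ⟧

data AlarmCondition (P : Plant) (D : Diagnoser P) : Set where
  ExactDel  : Diagnoser.Alarm D → PlantFormula P → ℕ → AlarmCondition P D
  BoundDel  : Diagnoser.Alarm D → PlantFormula P → ℕ → AlarmCondition P D
  FiniteDel : Diagnoser.Alarm D → PlantFormula P → AlarmCondition P D

alarmOf : ∀ {P D} → AlarmCondition P D → Diagnoser.Alarm D
alarmOf (ExactDel A _ _) = A
alarmOf (BoundDel A _ _) = A
alarmOf (FiniteDel A _)  = A

temporalCondition : ∀ {P D} → AlarmCondition P D → TProp P D
temporalCondition {P} {D} (ExactDel _ β d) = Yⁿ P D d (⟦_⟧ {P} {D} β)
temporalCondition {P} {D} (BoundDel _ β d) = O≤ P D d (⟦_⟧ {P} {D} β)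
temporalCondition {P} {D} (FiniteDel _ β)  = Oᶠ P D (⟦_⟧ {P} {D} β)

-- The diagnoser is deterministic and reads exactly the observable events,
-- so its state at a point of D ⊗ P is a function of the observation
-- sequence up to that point.  Observationally equivalent points therefore
-- agree on every alarm, and on being observation points; correctness of A
-- at every point equivalent to an alarmed observation point is exactly
-- knowledge of τ there.  Nothing about the shape of τ is used.
module Submission where

open import Defs
open import Data.Nat using (zero; suc; z≤n)
open import Data.Bool using (T; true; false; if_then_else_)
open import Data.Bool.Properties using (T-irrelevant)
open import Data.List using (List; []; _∷_; _∷ʳ_)
open import Data.List.Properties using (∷ʳ-injective)
open import Data.Product using (_,_; proj₁; proj₂)
open import Data.Sum using (inj₁; inj₂)
open import Data.Empty using (⊥; ⊥-elim)
open import Data.Unit using (tt)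
open import Relation.Binary.PropositionalEquality using (_≡_; refl; sym; trans; subst)

module _ (P : Plant) (D : Diagnoser P) where
  private
    module P = Plant P
    module D = Diagnoser D

  data Run : List P.Event → D.State → Set where
    run-init : ∀ {d} → D.Init d → Run [] d
    run-step : ∀ {l d d' e} → Run l d → (o : P.Observable e) →
               D.Trans (e , o) d d' → Run (l ∷ʳ e) d'

  Run-reachable : ∀ {l d} → Run l d → Reachable D.Init D.Trans d
  Run-reachable (run-init i)     = reach-init i
  Run-reachable (run-step r _ t) = reach-step (Run-reachable r) t

  []≢∷ʳ : ∀ (l : List P.Event) e → [] ≡ l ∷ʳ e → ⊥
  []≢∷ʳ []      e ()
  []≢∷ʳ (_ ∷ _) e ()

  Run-deterministic : ∀ {l l' d d'} → Run l d → Run l' d' → l ≡ l' → d ≡ d'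
  Run-deterministic (run-init i) (run-init i') _ =
    trans (unique _ i) (sym (unique _ i'))
    where unique = proj₂ (proj₂ D.detInit)
  Run-deterministic (run-init _) (run-step {l = l} {e = e} _ _ _) eq =
    ⊥-elim ([]≢∷ʳ l e eq)
  Run-deterministic (run-step {l = l} {e = e} _ _ _) (run-init _) eq =
    ⊥-elim ([]≢∷ʳ l e (sym eq))
  Run-deterministic (run-step {l = l} {d = d} {e = e} r o t) (run-step {l = l'} r' o' t') eq
    with ∷ʳ-injective l l' eq
  ... | l≡l' , refl with Run-deterministic r r' l≡l' | T-irrelevant o o'
  ... | refl | refl = trans (unique _ t) (sym (unique _ t'))
    where unique = proj₂ (proj₂ (D.detTrans d (Run-reachable r) (e , o)))

  Run-observe : ∀ {l d d' e} → Run l d → DStep P D e d d' →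
                Run (if P.obs e then l ∷ʳ e else l) d'
  Run-observe {l} {d} {d'} {e} r = observe (P.obs e) refl
    where
    observe : ∀ b → P.obs e ≡ b → DStep P D e d d' → Run (if b then l ∷ʳ e else l) d'
    observe true  _    (inj₁ (o , t))    = run-step r o t
    observe true  obs≡ (inj₂ (¬o , _))   = ⊥-elim (¬o (subst T (sym obs≡) tt))
    observe false obs≡ (inj₁ (o , _))    = ⊥-elim (subst T obs≡ o)
    observe false _    (inj₂ (_ , refl)) = r

  diagnoserRun : (σ : PTrace P D) → ∀ i → Run (obsSeq P D σ i) (proj₁ (states σ i))
  diagnoserRun σ zero    = run-init (proj₁ (init σ))
  diagnoserRun σ (suc i) = Run-observe (diagnoserRun σ i) (proj₂ (step σ i))

  obsSeq≡⇒diagnoserState≡ : ∀ σ₁ i σ₂ j → obsSeq P D σ₁ i ≡ obsSeq P D σ₂ j →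
                             proj₁ (states σ₁ i) ≡ proj₁ (states σ₂ j)
  obsSeq≡⇒diagnoserState≡ σ₁ i σ₂ j =
    Run-deterministic (diagnoserRun σ₁ i) (diagnoserRun σ₂ j)

  obsAlarm-resp-ObsEq : ∀ A σ₁ i σ₂ j → ObsEq P D σ₁ i σ₂ j →
                        [_]ₒ P D (alarmᶠ P D A) σ₁ i → [_]ₒ P D (alarmᶠ P D A) σ₂ j
  obsAlarm-resp-ObsEq A σ₁ (suc i) σ₂ (suc j) ((obs₁⇒obs₂ , _) , obsSeq≡) (alarm , obs₁) =
    subst (λ d → T (D.alarm A d)) (obsSeq≡⇒diagnoserState≡ σ₁ (suc i) σ₂ (suc j) obsSeq≡) alarm
    , obs₁⇒obs₂ obs₁
  obsAlarm-resp-ObsEq A σ₁ (suc i) σ₂ zero ((obs₁⇒obs₂ , _) , _) (_ , obs₁) =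
    ⊥-elim (obs₁⇒obs₂ obs₁)

  correctAlarm⇒knownCondition : ∀ A (τ : TProp P D) →
    Sat P D (Gᶠ P D (_⇒ᶠ_ P D ([_]ₒ P D (alarmᶠ P D A)) τ)) →
    Sat P D (Gᶠ P D (_⇒ᶠ_ P D ([_]ₒ P D (alarmᶠ P D A)) ([_]ₒ P D (Kᶠ P D τ))))
  correctAlarm⇒knownCondition A τ correct σ₁ i _ alarmed@(_ , obs₁) =
    (λ σ₂ j obsEq → correct σ₂ j z≤n (obsAlarm-resp-ObsEq A σ₁ i σ₂ j obsEq alarmed)) , obs₁

theorem4p2 : (P : Plant) (D : Diagnoser P) (ac : AlarmCondition P D) →
    Sat P D (Gᶠ P D (_⇒ᶠ_ P D ([_]ₒ P D (alarmᶠ P D (alarmOf ac))) (temporalCondition ac))) →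
    Sat P D (Gᶠ P D (_⇒ᶠ_ P D ([_]ₒ P D (alarmᶠ P D (alarmOf ac)))
                               ([_]ₒ P D (Kᶠ P D (temporalCondition ac)))))
theorem4p2 P D ac = correctAlarm⇒knownCondition P D (alarmOf ac) (temporalCondition ac)
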